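{- Let $\mathcal L$ be one of $\textup{FO}(<)$, $\textup{FO}(<,\equiv)$, $\textup{FO}(\textup{RPR})$, and let $\boldsymbol q=(\mathcal O,\psi)$ be an OMQ. If every OMPIQ $(\mathcal O,\varkappa)$ and $(\mathcal O,\varrho)$, for $\varkappa$ a positive temporal concept and $\varrho$ a positive temporal role occurring in $\psi$, is $\mathcal L$-rewritable, then $\boldsymbol q$ is $\mathcal L$-rewritable.
   Context: Temporal DL-Lite. Roles $S ::= P\mid P^-$ ($P$ a role name); temporalised roles $R ::= S\mid\Box_F R\mid\Box_P R\mid\bigcirc_F R\mid\bigcirc_P R$; basic concepts $A\mid\exists S$; temporalised concepts analogously. An ontology is a finite set of inclusions $\vartheta_1\sqcap\dots\sqcap\vartheta_k\sqsubseteq\vartheta_{k+1}\sqcup\dots\sqcup\vartheta_{k+m}$ between temporalised concepts or between temporalised roles (empty $\sqcap=\top$, empty $\sqcup=\bot$). Positive temporal concepts $\varkappa ::= \top\mid A\mid\exists S.\varkappa\mid\varkappa_1\sqcap\varkappa_2\mid\varkappa_1\sqcup\varkappa_2\mid op_1\varkappa\mid\varkappa_1\,op_2\,\varkappa_2$ and positive temporal roles $\varrho ::= S\mid\varrho_1\sqcap\varrho_2\mid\varrho_1\sqcup\varrho_2\mid op_1\varrho\mid\varrho_1\,op_2\,\varrho_2$, $op_1\in\{\bigcirc_F,\Diamond_F,\Box_F,\bigcirc_P,\Diamond_P,\Box_P\}$, $op_2\in\{\mathcal U,\mathcal S\}$, with the standard semantics in temporal interpretations over $\mathbb Z$ (constant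 domain, time-independent individuals, no unique name assumption; $\exists S.\varkappa$ at $n$ holds of $u$ iff some $S$-successor of $u$ at $n$ satisfies $\varkappa$ at $n$; $\Box/\Diamond$ quantify universally/existentially over all later or earlier moments; $\bigcirc$ is next/previous moment; $\mathcal U,\mathcal S$ are strict until/since). Inclusions hold at all moments; a model of $(\mathcal O,\mathcal A)$ satisfies $\mathcal O$ and all ABox assertions $A(a,\ell)$, $P(a,b,\ell)$ ($\ell\in\mathbb Z$). $\mathsf{tem}(\mathcal A)=\{n\mid\min\mathcal A\le n\le\max\mathcal A\}$. $\mathsf{ans}((\mathcal O,\varkappa),\mathcal A)$ is the set of $(a,\ell)\in\mathsf{ind}(\mathcal A)\times\mathsf{tem}(\mathcal A)$ with $a^{\mathcal I}\in\varkappa^{\mathcal I(\ell)}$ in every model; $\mathsf{ans}((\mathcal O,\varrho),\mathcal A)$ the set of such triples $(a,b,\ell)$. An OMPIQ is $(\mathcal O,\varkappa)$ or $(\mathcal O,\varrho)$. OMQs. An OMQ is $\boldsymbol q=(\mathcal O,\psi(\vec x,\vec t))$ where $\psi$ is a two-sorted first-order formula built from atoms $\varkappa(x,t)$, $\varrho(x,y,t)$ and $t<t'$, with $x,y$ individual variables and $t,t'$ temporal variables; $\vec x,\vec t$ are its free variables. Given an ABox $\mathcal A$ and an assignment $\mathfrak a$ sending individual variables into $\mathsf{ind}(\mathcal A)$ and temporal variables into $\mathsf{tem}(\mathcal A)$: $\varkappa(x,t)$ is true iff $(\mathfrak a(x),\mathfrak a(t))\in\mathsf{ans}((\mathcal O,\varkappa),\mathcal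 A)$; $\varrho(x,y,t)$ is true iff $(\mathfrak a(x),\mathfrak a(y),\mathfrak a(t))\in\mathsf{ans}((\mathcal O,\varrho),\mathcal A)$; $t<t'$ iff $\mathfrak a(t)<\mathfrak a(t')$; Boolean connectives are standard and quantifiers range over $\mathsf{ind}(\mathcal A)$ and $\mathsf{tem}(\mathcal A)$ respectively. A tuple $(\vec a,\vec\ell)$ is an answer to $\boldsymbol q$ over $\mathcal A$ if $\psi$ is true under the assignment $\vec x\mapsto\vec a$, $\vec t\mapsto\vec\ell$. Rewritings. ABoxes with $\mathsf{ind}(\mathcal A)=\{a_0,\dots,a_m\}$ are normalised (dummy assertions) so that $\min\mathcal A=0$, $\max\mathcal A\ge\max(1,m)$; $a_k$ is identified with $k$; $\mathfrak S_{\mathcal A}$ has domain $\mathsf{tem}(\mathcal A)$, order $<$, and atoms $A(k,\ell)$, $P(k,k',\ell)$ true iff the assertion is in $\mathcal A$. $\textup{FO}(<)$: first-order formulas with such atoms, $=$, $<$; $\textup{FO}(<,\equiv)$: also $t\equiv0\pmod n$ for fixed $n>1$; $\textup{FO}(\textup{RPR})$: $\textup{FO}(<)$ with relational primitive recursion (predicates defined by simultaneous recursion on a time argument from $0$, with value false at $-1$). An OMPIQ is $\mathcal L$-rewritable if some constant-free $\mathcal L$-formula $\boldsymbol Q(x,t)$ (resp. $\boldsymbol Q(x,y,t)$) defines exactly its certain answers in $\mathfrak S_{\mathcal A}$ (over $\mathsf{ind}(\mathcal A)$ and $\mathsf{tem}(\mathcal A)$) for every ABox $\mathcal A$. An OMQ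 $\boldsymbol q$ is $\mathcal L$-rewritable if there is an $\mathcal L$-formula $\boldsymbol Q(\vec x,\vec t)$ such that for every ABox $\mathcal A$ and tuples $\vec a$ in $\mathsf{ind}(\mathcal A)$, $\vec\ell$ in $\mathsf{tem}(\mathcal A)$: $(\vec a,\vec\ell)$ is an answer to $\boldsymbol q$ over $\mathcal A$ iff $\mathfrak S_{\mathcal A}\models\boldsymbol Q(\vec a,\vec\ell)$. -}

module Defs where

open import Level using (Level; 0ℓ) renaming (suc to lsuc)
open import Data.Nat as ℕ using (ℕ; zero; suc; _≤_; _<_)
open import Data.Nat.Divisibility using (_∣_)
open import Data.Integer as ℤ using (ℤ; +_) renaming (_≤_ to _≤ℤ_; _<_ to _<ℤ_; _+_ to _+ℤ_; _-_ to _-ℤ_)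
open import Data.List using (List; []; _∷_; _++_; map)
open import Data.List.Membership.Propositional using (_∈_)
open import Data.Vec using (Vec; []; _∷_)
open import Data.Product using (Σ; Σ-syntax; ∃; ∃-syntax; _×_; _,_)
open import Data.Sum using (_⊎_)
open import Data.Unit using (⊤)
open import Data.Empty using (⊥)
open import Relation.Nullary using (¬_)
open import Relation.Binary.PropositionalEquality using (_≡_)
open import Function.Bundles using (_⇔_)

ConceptName RoleName IndName : Set
ConceptName = ℕ
RoleName    = ℕ
IndName     = ℕ

data Role : Set where
  rn  : RoleName → Role
  inv : RoleName → Role

data TRole : Set where
  base : Role → TRole
  □F □P ○F ○P : TRole → TRole

data BConcept : Set where
  atom : ConceptName → BConcept
  some : Role → BConcept

data TConcept : Set where
  base : BConcept → TConcept
  □F □P ○F ○P : TConcept → TConcept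

-- inclusions  ϑ₁ ⊓ … ⊓ ϑₖ ⊑ ϑₖ₊₁ ⊔ … ⊔ ϑₖ₊ₘ  (lists: empty ⊓ = ⊤, empty ⊔ = ⊥)
data Inclusion : Set where
  conceptIncl : List TConcept → List TConcept → Inclusion
  roleIncl    : List TRole    → List TRole    → Inclusion

Ontology : Set
Ontology = List Inclusion

data PConcept : Set where
  top    : PConcept
  atom   : ConceptName → PConcept
  exists : Role → PConcept → PConcept
  _⊓_ _⊔_ : PConcept → PConcept → PConcept
  ○F ◇F □F ○P ◇P □P : PConcept → PConcept
  _𝒰_ _𝒮_ : PConcept → PConcept → PConcept

data PRole : Set where
  role    : Role → PRole
  _⊓_ _⊔_ : PRole → PRole → PRole
  ○F ◇F □F ○P ◇P □P : PRole → PRole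
  _𝒰_ _𝒮_ : PRole → PRole → PRole

data Assertion : Set where
  cAss : ConceptName → IndName → ℤ → Assertion
  rAss : RoleName → IndName → IndName → ℤ → Assertion

ABox : Set
ABox = List Assertion

time : Assertion → ℤ
time (cAss _ _ ℓ)   = ℓ
time (rAss _ _ _ ℓ) = ℓ

data Occurs (a : IndName) : Assertion → Set where
  inC  : ∀ {A ℓ}   → Occurs a (cAss A a ℓ)
  inR₁ : ∀ {P b ℓ} → Occurs a (rAss P a b ℓ)
  inR₂ : ∀ {P b ℓ} → Occurs a (rAss P b a ℓ)

InInd : ABox → IndName → Set
InInd 𝒜 a = Σ[ α ∈ Assertion ] (α ∈ 𝒜 × Occurs a α)

InTem : ABox → ℤ → Set
InTem 𝒜 n = (Σ[ α ∈ Assertion ] (α ∈ 𝒜 × time α ≤ℤ n))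
          × (Σ[ β ∈ Assertion ] (β ∈ 𝒜 × n ≤ℤ time β))

-- Temporal interpretations over ℤ (constant domain, rigid individuals,
-- no unique name assumption)

record Interp : Set₁ where
  field
    Δ    : Set
    ind  : IndName → Δ
    conc : ConceptName → ℤ → Δ → Set
    rol  : RoleName → ℤ → Δ → Δ → Set
open Interp public

module Sem (I : Interp) where

  ⟦_⟧S : Role → ℤ → Δ I → Δ I → Set
  ⟦ rn P  ⟧S n u v = rol I P n u v
  ⟦ inv P ⟧S n u v = rol I P n v u

  ⟦_⟧TR : TRole → ℤ → Δ I → Δ I → Set
  ⟦ base S ⟧TR n u v = ⟦ S ⟧S n u v
  ⟦ □F R ⟧TR n u v = ∀ m → n <ℤ m → ⟦ R ⟧TR m u v
  ⟦ □P R ⟧TR n u v = ∀ m → m <ℤ n → ⟦ R ⟧TR m u v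
  ⟦ ○F R ⟧TR n u v = ⟦ R ⟧TR (n +ℤ + 1) u v
  ⟦ ○P R ⟧TR n u v = ⟦ R ⟧TR (n -ℤ + 1) u v

  ⟦_⟧B : BConcept → ℤ → Δ I → Set
  ⟦ atom A ⟧B n u = conc I A n u
  ⟦ some S ⟧B n u = Σ[ v ∈ Δ I ] ⟦ S ⟧S n u v

  ⟦_⟧TC : TConcept → ℤ → Δ I → Set
  ⟦ base B ⟧TC n u = ⟦ B ⟧B n u
  ⟦ □F C ⟧TC n u = ∀ m → n <ℤ m → ⟦ C ⟧TC m u
  ⟦ □P C ⟧TC n u = ∀ m → m <ℤ n → ⟦ C ⟧TC m u
  ⟦ ○F C ⟧TC n u = ⟦ C ⟧TC (n +ℤ + 1) u
  ⟦ ○P C ⟧TC n u = ⟦ C ⟧TC (n -ℤ + 1) u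

  ⋀ : List Set → Set
  ⋀ []       = ⊤
  ⋀ (X ∷ Xs) = X × ⋀ Xs

  ⋁ : List Set → Set
  ⋁ []       = ⊥
  ⋁ (X ∷ Xs) = X ⊎ ⋁ Xs

  SatIncl : Inclusion → Set
  SatIncl (conceptIncl ls rs) = ∀ n u →
    ⋀ (map (λ C → ⟦ C ⟧TC n u) ls) → ⋁ (map (λ C → ⟦ C ⟧TC n u) rs)
  SatIncl (roleIncl ls rs) = ∀ n u v →
    ⋀ (map (λ R → ⟦ R ⟧TR n u v) ls) → ⋁ (map (λ R → ⟦ R ⟧TR n u v) rs)

  SatOnt : Ontology → Set
  SatOnt 𝒪 = ∀ ι → ι ∈ 𝒪 → SatIncl ι

  SatAss : Assertion → Set
  SatAss (cAss A a ℓ)   = conc I A ℓ (ind I a)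
  SatAss (rAss P a b ℓ) = rol I P ℓ (ind I a) (ind I b)

  Model : Ontology → ABox → Set
  Model 𝒪 𝒜 = SatOnt 𝒪 × (∀ α → α ∈ 𝒜 → SatAss α)

  ⟦_⟧κ : PConcept → ℤ → Δ I → Set
  ⟦ top ⟧κ n u = ⊤
  ⟦ atom A ⟧κ n u = conc I A n u
  ⟦ exists S κ ⟧κ n u = Σ[ v ∈ Δ I ] (⟦ S ⟧S n u v × ⟦ κ ⟧κ n v)
  ⟦ κ₁ ⊓ κ₂ ⟧κ n u = ⟦ κ₁ ⟧κ n u × ⟦ κ₂ ⟧κ n u
  ⟦ κ₁ ⊔ κ₂ ⟧κ n u = ⟦ κ₁ ⟧κ n u ⊎ ⟦ κ₂ ⟧κ n u
  ⟦ ○F κ ⟧κ n u = ⟦ κ ⟧κ (n +ℤ + 1) u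
  ⟦ ◇F κ ⟧κ n u = Σ[ m ∈ ℤ ] (n <ℤ m × ⟦ κ ⟧κ m u)
  ⟦ □F κ ⟧κ n u = ∀ m → n <ℤ m → ⟦ κ ⟧κ m u
  ⟦ ○P κ ⟧κ n u = ⟦ κ ⟧κ (n -ℤ + 1) u
  ⟦ ◇P κ ⟧κ n u = Σ[ m ∈ ℤ ] (m <ℤ n × ⟦ κ ⟧κ m u)
  ⟦ □P κ ⟧κ n u = ∀ m → m <ℤ n → ⟦ κ ⟧κ m u
  ⟦ κ₁ 𝒰 κ₂ ⟧κ n u = Σ[ m ∈ ℤ ] (n <ℤ m × ⟦ κ₂ ⟧κ m u
                       × (∀ k → n <ℤ k → k <ℤ m → ⟦ κ₁ ⟧κ k u))
  ⟦ κ₁ 𝒮 κ₂ ⟧κ n u = Σ[ m ∈ ℤ ] (m <ℤ n × ⟦ κ₂ ⟧κ m u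
                       × (∀ k → m <ℤ k → k <ℤ n → ⟦ κ₁ ⟧κ k u))

  ⟦_⟧ϱ : PRole → ℤ → Δ I → Δ I → Set
  ⟦ role S ⟧ϱ n u v = ⟦ S ⟧S n u v
  ⟦ ϱ₁ ⊓ ϱ₂ ⟧ϱ n u v = ⟦ ϱ₁ ⟧ϱ n u v × ⟦ ϱ₂ ⟧ϱ n u v
  ⟦ ϱ₁ ⊔ ϱ₂ ⟧ϱ n u v = ⟦ ϱ₁ ⟧ϱ n u v ⊎ ⟦ ϱ₂ ⟧ϱ n u v
  ⟦ ○F ϱ ⟧ϱ n u v = ⟦ ϱ ⟧ϱ (n +ℤ + 1) u v
  ⟦ ◇F ϱ ⟧ϱ n u v = Σ[ m ∈ ℤ ] (n <ℤ m × ⟦ ϱ ⟧ϱ m u v)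
  ⟦ □F ϱ ⟧ϱ n u v = ∀ m → n <ℤ m → ⟦ ϱ ⟧ϱ m u v
  ⟦ ○P ϱ ⟧ϱ n u v = ⟦ ϱ ⟧ϱ (n -ℤ + 1) u v
  ⟦ ◇P ϱ ⟧ϱ n u v = Σ[ m ∈ ℤ ] (m <ℤ n × ⟦ ϱ ⟧ϱ m u v)
  ⟦ □P ϱ ⟧ϱ n u v = ∀ m → m <ℤ n → ⟦ ϱ ⟧ϱ m u v
  ⟦ ϱ₁ 𝒰 ϱ₂ ⟧ϱ n u v = Σ[ m ∈ ℤ ] (n <ℤ m × ⟦ ϱ₂ ⟧ϱ m u v
                         × (∀ k → n <ℤ k → k <ℤ m → ⟦ ϱ₁ ⟧ϱ k u v))
  ⟦ ϱ₁ 𝒮 ϱ₂ ⟧ϱ n u v = Σ[ m ∈ ℤ ] (m <ℤ n × ⟦ ϱ₂ ⟧ϱ m u v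
                         × (∀ k → m <ℤ k → k <ℤ n → ⟦ ϱ₁ ⟧ϱ k u v))

open Sem public

-- Certain answers (membership in ind(𝒜) × tem(𝒜) is imposed separately)

CertainC : Ontology → PConcept → ABox → IndName → ℤ → Set₁
CertainC 𝒪 κ 𝒜 a ℓ = ∀ (I : Interp) → Model I 𝒪 𝒜 → ⟦_⟧κ I κ ℓ (ind I a)

CertainR : Ontology → PRole → ABox → IndName → IndName → ℤ → Set₁
CertainR 𝒪 ϱ 𝒜 a b ℓ =
  ∀ (I : Interp) → Model I 𝒪 𝒜 → ⟦_⟧ϱ I ϱ ℓ (ind I a) (ind I b)

-- OMQ formulas ψ: two-sorted FO with atoms κ(x,t), ϱ(x,y,t), t < t'.
-- Individual and temporal variables are natural numbers (separate sorts).

IVar TVar : Set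
IVar = ℕ
TVar = ℕ

data QFormula : Set where
  qtrue qfalse : QFormula
  cAtom : PConcept → IVar → TVar → QFormula
  rAtom : PRole → IVar → IVar → TVar → QFormula
  tLess : TVar → TVar → QFormula
  qnot  : QFormula → QFormula
  qand qor qimp : QFormula → QFormula → QFormula
  qexI qallI : IVar → QFormula → QFormula
  qexT qallT : TVar → QFormula → QFormula

_[_↦_] : {A : Set} → (ℕ → A) → ℕ → A → ℕ → A
(f [ x ↦ a ]) y with ℕ._≟_ x y
... | Relation.Nullary.yes _ = a
... | Relation.Nullary.no  _ = f y

QTrue : Ontology → ABox → QFormula → (IVar → IndName) → (TVar → ℤ) → Set₁
QTrue 𝒪 𝒜 qtrue σ τ = Level.Lift (lsuc 0ℓ) ⊤
QTrue 𝒪 𝒜 qfalse σ τ = Level.Lift (lsuc 0ℓ) ⊥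
QTrue 𝒪 𝒜 (cAtom κ x t) σ τ = CertainC 𝒪 κ 𝒜 (σ x) (τ t)
QTrue 𝒪 𝒜 (rAtom ϱ x y t) σ τ = CertainR 𝒪 ϱ 𝒜 (σ x) (σ y) (τ t)
QTrue 𝒪 𝒜 (tLess t t') σ τ = Level.Lift (lsuc 0ℓ) (τ t <ℤ τ t')
QTrue 𝒪 𝒜 (qnot φ) σ τ = ¬ QTrue 𝒪 𝒜 φ σ τ
QTrue 𝒪 𝒜 (qand φ χ) σ τ = QTrue 𝒪 𝒜 φ σ τ × QTrue 𝒪 𝒜 χ σ τ
QTrue 𝒪 𝒜 (qor φ χ) σ τ = QTrue 𝒪 𝒜 φ σ τ ⊎ QTrue 𝒪 𝒜 χ σ τ
QTrue 𝒪 𝒜 (qimp φ χ) σ τ = QTrue 𝒪 𝒜 φ σ τ → QTrue 𝒪 𝒜 χ σ τ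
QTrue 𝒪 𝒜 (qexI x φ) σ τ =
  Σ[ a ∈ IndName ] (Level.Lift (lsuc 0ℓ) (InInd 𝒜 a) × QTrue 𝒪 𝒜 φ (σ [ x ↦ a ]) τ)
QTrue 𝒪 𝒜 (qallI x φ) σ τ =
  ∀ a → InInd 𝒜 a → QTrue 𝒪 𝒜 φ (σ [ x ↦ a ]) τ
QTrue 𝒪 𝒜 (qexT t φ) σ τ =
  Σ[ ℓ ∈ ℤ ] (Level.Lift (lsuc 0ℓ) (InTem 𝒜 ℓ) × QTrue 𝒪 𝒜 φ σ (τ [ t ↦ ℓ ]))
QTrue 𝒪 𝒜 (qallT t φ) σ τ =
  ∀ ℓ → InTem 𝒜 ℓ → QTrue 𝒪 𝒜 φ σ (τ [ t ↦ ℓ ])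

conceptsOf : QFormula → List PConcept
conceptsOf (cAtom κ _ _) = κ ∷ []
conceptsOf (qnot φ) = conceptsOf φ
conceptsOf (qand φ χ) = conceptsOf φ ++ conceptsOf χ
conceptsOf (qor φ χ) = conceptsOf φ ++ conceptsOf χ
conceptsOf (qimp φ χ) = conceptsOf φ ++ conceptsOf χ
conceptsOf (qexI _ φ) = conceptsOf φ
conceptsOf (qallI _ φ) = conceptsOf φ
conceptsOf (qexT _ φ) = conceptsOf φ
conceptsOf (qallT _ φ) = conceptsOf φ
conceptsOf _ = []

rolesOf : QFormula → List PRole
rolesOf (rAtom ϱ _ _ _) = ϱ ∷ []
rolesOf (qnot φ) = rolesOf φ
rolesOf (qand φ χ) = rolesOf φ ++ rolesOf χ
rolesOf (qor φ χ) = rolesOf φ ++ rolesOf χ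
rolesOf (qimp φ χ) = rolesOf φ ++ rolesOf χ
rolesOf (qexI _ φ) = rolesOf φ
rolesOf (qallI _ φ) = rolesOf φ
rolesOf (qexT _ φ) = rolesOf φ
rolesOf (qallT _ φ) = rolesOf φ
rolesOf _ = []

-- Target languages: one-sorted first-order formulas over 𝔖_𝒜
-- (domain tem(𝒜) = {0,…,max 𝒜} for a normalised ABox), with
-- optional modular atoms and relational primitive recursion.

Var : Set
Var = ℕ

data PVar : List ℕ → ℕ → Set where
  here  : ∀ {Γ a} → PVar (a ∷ Γ) a
  there : ∀ {Γ a b} → PVar Γ a → PVar (b ∷ Γ) a

data Fm (Γ : List ℕ) : Set where
  tt ff : Fm Γ
  cAt   : ConceptName → Var → Var → Fm Γ
  rAt   : RoleName → Var → Var → Var → Fm Γ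
  eqAt  : Var → Var → Fm Γ
  ltAt  : Var → Var → Fm Γ
  modAt : ℕ → Var → Fm Γ
  pAt   : ∀ {a} → PVar Γ a → Vec Var a → Fm Γ
  neg   : Fm Γ → Fm Γ
  and or imp : Fm Γ → Fm Γ → Fm Γ
  ex all : Var → Fm Γ → Fm Γ
  -- [ R_i(z⃗_i, t) ≡ Θ_i ]_{i} Ψ  for predicates of arities `as`
  -- (the time argument not counted).  In Θ_i the variables 0,…,aᵢ-1 are z⃗_i,
  -- variable aᵢ is t, other variables are parameters from the context, and
  -- an atom R_j(y⃗) stands for R_j(y⃗, t-1).  In Ψ, R_j has one extra
  -- (first) argument, the time point: R_j(t, y⃗).
  rpr   : (as : List ℕ) → (∀ {a} → PVar as a → Fm (as ++ Γ))
        → Fm (map suc as ++ Γ) → Fm Γ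

data Logic : Set where
  FO< FO<≡ FORPR : Logic

InL : ∀ {Γ} → Logic → Fm Γ → Set
InL L tt = ⊤
InL L ff = ⊤
InL L (cAt _ _ _) = ⊤
InL L (rAt _ _ _ _) = ⊤
InL L (eqAt _ _) = ⊤
InL L (ltAt _ _) = ⊤
InL FO<≡ (modAt n _) = 2 ≤ n
InL _    (modAt n _) = ⊥
InL L (pAt _ _) = ⊤
InL L (neg φ) = InL L φ
InL L (and φ χ) = InL L φ × InL L χ
InL L (or φ χ) = InL L φ × InL L χ
InL L (imp φ χ) = InL L φ × InL L χ
InL L (ex _ φ) = InL L φ
InL L (all _ φ) = InL L φ
InL FORPR (rpr as Θ Ψ) = (∀ {a} (v : PVar as a) → InL FORPR (Θ v)) × InL FORPR Ψ
InL _     (rpr _ _ _) = ⊥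

PEnv : List ℕ → Set₁
PEnv Γ = ∀ {a} → PVar Γ a → Vec ℕ a → Set

appendEnv : ∀ {Γ} (as : List ℕ) → PEnv as → PEnv Γ → PEnv (as ++ Γ)
appendEnv [] ρ₁ ρ₂ v = ρ₂ v
appendEnv (a ∷ as) ρ₁ ρ₂ here = ρ₁ here
appendEnv (a ∷ as) ρ₁ ρ₂ (there v) = appendEnv as (λ w → ρ₁ (there w)) ρ₂ v

-- stages S n = relations at time n-1; relation with explicit time argument
liftEnv : (as : List ℕ) → (ℕ → PEnv as) → PEnv (map suc as)
liftEnv (a ∷ as) S here (t ∷ z) = S (suc t) here z
liftEnv (a ∷ as) S (there v) = liftEnv as (λ n w → S n (there w)) v

override : ∀ {a} → Vec ℕ a → ℕ → (Var → ℕ) → Var → ℕ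
override [] t ρ zero = t
override [] t ρ (suc n) = ρ (suc n)
override (z ∷ zs) t ρ zero = z
override (z ∷ zs) t ρ (suc n) = override zs t (λ m → ρ (suc m)) n

lookupV : ∀ {a} → Vec Var a → (Var → ℕ) → Vec ℕ a
lookupV [] ρ = []
lookupV (x ∷ xs) ρ = ρ x ∷ lookupV xs ρ

Eval : ABox → ∀ {Γ} → Fm Γ → (Var → ℕ) → PEnv Γ → Set
Eval 𝒜 tt ρ η = ⊤
Eval 𝒜 ff ρ η = ⊥
Eval 𝒜 (cAt A x t) ρ η = cAss A (ρ x) (+ ρ t) ∈ 𝒜
Eval 𝒜 (rAt P x y t) ρ η = rAss P (ρ x) (ρ y) (+ ρ t) ∈ 𝒜
Eval 𝒜 (eqAt x y) ρ η = ρ x ≡ ρ y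
Eval 𝒜 (ltAt x y) ρ η = ρ x < ρ y
Eval 𝒜 (modAt n x) ρ η = n ∣ ρ x
Eval 𝒜 (pAt v xs) ρ η = η v (lookupV xs ρ)
Eval 𝒜 (neg φ) ρ η = ¬ Eval 𝒜 φ ρ η
Eval 𝒜 (and φ χ) ρ η = Eval 𝒜 φ ρ η × Eval 𝒜 χ ρ η
Eval 𝒜 (or φ χ) ρ η = Eval 𝒜 φ ρ η ⊎ Eval 𝒜 χ ρ η
Eval 𝒜 (imp φ χ) ρ η = Eval 𝒜 φ ρ η → Eval 𝒜 χ ρ η
Eval 𝒜 (ex x φ) ρ η = Σ[ n ∈ ℕ ] (InTem 𝒜 (+ n) × Eval 𝒜 φ (ρ [ x ↦ n ]) η)
Eval 𝒜 (all x φ) ρ η = ∀ n → InTem 𝒜 (+ n) → Eval 𝒜 φ (ρ [ x ↦ n ]) η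
Eval 𝒜 {Γ} (rpr as Θ Ψ) ρ η = Eval 𝒜 Ψ ρ (appendEnv (map suc as) (liftEnv as stage) η)
  where
  stage : ℕ → PEnv as
  stage zero v z = ⊥
  stage (suc n) v z = Eval 𝒜 (Θ v) (override z n ρ) (appendEnv as (stage n) η)

record Signature : Set where
  field
    concepts : List ConceptName
    roles    : List RoleName
open Signature public

InSig : Signature → Assertion → Set
InSig Σ' (cAss A _ _)   = A ∈ concepts Σ'
InSig Σ' (rAss P _ _ _) = P ∈ roles Σ'

SigABox : Signature → ABox → Set
SigABox Σ' 𝒜 = ∀ α → α ∈ 𝒜 → InSig Σ' α

Normalised : ABox → Set
Normalised 𝒜 =
    (Σ[ α ∈ Assertion ] (α ∈ 𝒜 × time α ≡ + 0))
  × (∀ α → α ∈ 𝒜 → + 0 ≤ℤ time α)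
  × (Σ[ m ∈ ℕ ] ((∀ k → InInd 𝒜 k ⇔ k ≤ m)
      × (Σ[ α ∈ Assertion ] (α ∈ 𝒜 × + 1 ≤ℤ time α × + m ≤ℤ time α))))

RewritableC : Logic → Signature → Ontology → PConcept → Set₁
RewritableC L Σ' 𝒪 κ = Σ[ Q ∈ Fm [] ] (InL L Q ×
  (∀ 𝒜 → SigABox Σ' 𝒜 → Normalised 𝒜 →
   ∀ (ρ : Var → ℕ) → (∀ v → InTem 𝒜 (+ ρ v)) → InInd 𝒜 (ρ 0) →
   (Eval 𝒜 Q ρ (λ ()) ⇔ CertainC 𝒪 κ 𝒜 (ρ 0) (+ ρ 1))))

RewritableR : Logic → Signature → Ontology → PRole → Set₁
RewritableR L Σ' 𝒪 ϱ = Σ[ Q ∈ Fm [] ] (InL L Q ×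
  (∀ 𝒜 → SigABox Σ' 𝒜 → Normalised 𝒜 →
   ∀ (ρ : Var → ℕ) → (∀ v → InTem 𝒜 (+ ρ v)) → InInd 𝒜 (ρ 0) → InInd 𝒜 (ρ 1) →
   (Eval 𝒜 Q ρ (λ ()) ⇔ CertainR 𝒪 ϱ 𝒜 (ρ 0) (ρ 1) (+ ρ 2))))

-- individual variable i of ψ ↦ variable 2i of Q; temporal variable j ↦ 2j+1
interleave : (ℕ → ℕ) → (ℕ → ℕ) → Var → ℕ
interleave σ τ zero = σ 0
interleave σ τ (suc zero) = τ 0
interleave σ τ (suc (suc n)) = interleave (λ i → σ (suc i)) (λ j → τ (suc j)) n

RewritableQ : Logic → Signature → Ontology → QFormula → Set₁
RewritableQ L Σ' 𝒪 ψ = Σ[ Q ∈ Fm [] ] (InL L Q ×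
  (∀ 𝒜 → SigABox Σ' 𝒜 → Normalised 𝒜 →
   ∀ (σ τ : ℕ → ℕ) → (∀ i → InInd 𝒜 (σ i)) → (∀ j → InTem 𝒜 (+ τ j)) →
   (QTrue 𝒪 𝒜 ψ σ (λ j → + τ j) ⇔ Eval 𝒜 Q (interleave σ τ) (λ ()))))

-- An atom κ(x,t) or ϱ(x,y,t)
-- becomes the given rewriting of κ or ϱ with its free variables 0,1(,2) bound to
-- the variables that encode x, y and t; connectives are kept; an individual
-- quantifier is relativised to an FO(<)-definition of ind(𝒜), which exists because
-- the signature is finite; temporal quantifiers already range over tem(𝒜). The
-- target logic is closed under all of these constructions.
module Submission where

open import Defs
open import Level using (lift; lower)
open import Data.Nat as ℕ using (ℕ; zero; suc; _+_; _≤_; _<_; s≤s)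
import Data.Nat.Properties as ℕP
open import Data.Integer as ℤ using (ℤ; +_; +<+) renaming (_≤_ to _≤ℤ_; _<_ to _<ℤ_)
open import Data.Integer.Properties using (≤-refl; ≤-trans; drop‿+<+; 0≤i⇒+∣i∣≡i)
open import Data.List using (List; []; _∷_; map; length)
open import Data.List.Properties using (∷-injectiveˡ; ∷-injectiveʳ; map-cong-local)
open import Data.List.Membership.Propositional using (_∈_; lose)
open import Data.List.Relation.Unary.All as All using (All; []; _∷_)
open import Data.List.Relation.Unary.All.Properties using (++⁻ˡ; ++⁻ʳ)
open import Data.List.Relation.Unary.Any using (Any; here; there; satisfied)
open import Data.Product using (Σ-syntax; ∃; _×_; _,_; proj₁; proj₂)
open import Data.Product.Function.NonDependent.Propositional using (_×-⇔_)
open import Data.Sum using (_⊎_; inj₁; inj₂)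
open import Data.Sum.Function.Propositional using (_⊎-⇔_)
open import Data.Empty using (⊥-elim)
open import Function using (id; _∘_)
open import Function.Bundles using (_⇔_; mk⇔; Equivalence)
open import Function.Construct.Composition using (_⇔-∘_)
open import Function.Construct.Symmetry using (⇔-sym)
open import Function.Related.TypeIsomorphisms using (→-cong-⇔; ¬-cong-⇔)
open import Relation.Binary.PropositionalEquality
open import Relation.Nullary using (Dec; yes; no)

open Equivalence

module _ {A : Set} (f : ℕ → A) (x : ℕ) (a : A) where

  update-same : (f [ x ↦ a ]) x ≡ a
  update-same with x ℕ.≟ x
  ... | yes _ = refl
  ... | no x≢x = ⊥-elim (x≢x refl)

  update-other : ∀ {y} → x ≢ y → (f [ x ↦ a ]) y ≡ f y
  update-other {y} x≢y with x ℕ.≟ y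
  ... | yes x≡y = ⊥-elim (x≢y x≡y)
  ... | no _ = refl

  update-preserves : (P : A → Set) → (∀ y → P (f y)) → P a → ∀ y → P ((f [ x ↦ a ]) y)
  update-preserves P Pf Pa y with x ℕ.≟ y
  ... | yes _ = Pa
  ... | no _ = Pf y

update-reindex : ∀ {A B : Set} (h : A → B) {g : ℕ → ℕ} → (∀ {i j} → g i ≡ g j → i ≡ j)
  → ∀ {ρ : ℕ → A} {σ : ℕ → B} → (∀ i → h (ρ (g i)) ≡ σ i)
  → ∀ x a i → h ((ρ [ g x ↦ a ]) (g i)) ≡ (σ [ x ↦ h a ]) i
update-reindex h {g} g-inj {ρ} {σ} agree x a i = by-cases (x ℕ.≟ i)
  where
  by-cases : Dec (x ≡ i) → h ((ρ [ g x ↦ a ]) (g i)) ≡ (σ [ x ↦ h a ]) i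
  by-cases (yes refl) = trans (cong h (update-same ρ (g x) a)) (sym (update-same σ x (h a)))
  by-cases (no x≢i) = trans (cong h (update-other ρ (g x) a (x≢i ∘ g-inj)))
                            (trans (agree i) (sym (update-other σ x (h a) x≢i)))

-- Individual variable i of ψ is variable 2i of the rewriting, temporal variable j is 2j+1.
ivar tvar : ℕ → Var
ivar zero = 0
ivar (suc i) = suc (suc (ivar i))
tvar j = suc (ivar j)

ivar-injective : ∀ {i j} → ivar i ≡ ivar j → i ≡ j
ivar-injective {zero} {zero} _ = refl
ivar-injective {suc i} {suc j} e = cong suc (ivar-injective (ℕP.suc-injective (ℕP.suc-injective e)))

tvar-injective : ∀ {i j} → tvar i ≡ tvar j → i ≡ j
tvar-injective = ivar-injective ∘ ℕP.suc-injective

ivar≢tvar : ∀ i j → ivar i ≢ tvar j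
ivar≢tvar zero j ()
ivar≢tvar (suc i) zero ()
ivar≢tvar (suc i) (suc j) e = ivar≢tvar i j (ℕP.suc-injective (ℕP.suc-injective e))

ivar-or-tvar : ∀ v → (∃ λ i → ivar i ≡ v) ⊎ (∃ λ j → tvar j ≡ v)
ivar-or-tvar zero = inj₁ (0 , refl)
ivar-or-tvar (suc zero) = inj₂ (0 , refl)
ivar-or-tvar (suc (suc v)) with ivar-or-tvar v
... | inj₁ (i , refl) = inj₁ (suc i , refl)
... | inj₂ (j , refl) = inj₂ (suc j , refl)

interleave-ivar : ∀ σ τ i → interleave σ τ (ivar i) ≡ σ i
interleave-ivar σ τ zero = refl
interleave-ivar σ τ (suc i) = interleave-ivar (σ ∘ suc) (τ ∘ suc) i

interleave-tvar : ∀ σ τ j → interleave σ τ (tvar j) ≡ τ j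
interleave-tvar σ τ zero = refl
interleave-tvar σ τ (suc j) = interleave-tvar (σ ∘ suc) (τ ∘ suc) j

letIn : ∀ {Γ} → Var → Var → Fm Γ → Fm Γ
letIn u a φ = ex u (and (eqAt u a) φ)

block : Var → ℕ → List Var
block t zero = []
block t (suc n) = t ∷ block (suc t) n

length-block : ∀ t n → length (block t n) ≡ n
length-block t zero = refl
length-block t (suc n) = cong suc (length-block (suc t) n)

block-≥ : ∀ t n → All (t ≤_) (block t n)
block-≥ t zero = []
block-≥ t (suc n) = ℕP.≤-refl ∷ All.map ℕP.<⇒≤ (block-≥ (suc t) n)

assignFrom : ∀ {Γ} → Var → List Var → Fm Γ → Fm Γ
assignFrom t [] φ = φ
assignFrom t (x ∷ xs) φ = letIn t x (assignFrom (suc t) xs φ)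

Outside : Var → ℕ → Var → Set
Outside t n x = x < t ⊎ t + n ≤ x

outside-≢ : ∀ {t n x} → Outside t (suc n) x → t ≢ x
outside-≢ (inj₁ x<t) = ℕP.>⇒≢ x<t
outside-≢ {t} (inj₂ t+1+n≤x) = ℕP.<⇒≢ (ℕP.<-≤-trans (ℕP.m<m+n t (s≤s ℕ.z≤n)) t+1+n≤x)

outside-suc : ∀ {t n x} → Outside t (suc n) x → Outside (suc t) n x
outside-suc (inj₁ x<t) = inj₁ (ℕP.m<n⇒m<1+n x<t)
outside-suc {t} {n} {x} (inj₂ t+1+n≤x) = inj₂ (subst (_≤ x) (ℕP.+-suc t n) t+1+n≤x)

fresh : List Var → Var
fresh [] = 0
fresh (x ∷ xs) = suc (x + fresh xs)

fresh-> : ∀ xs → All (_< fresh xs) xs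
fresh-> [] = []
fresh-> (x ∷ xs) = s≤s (ℕP.m≤m+n x _)
  ∷ All.map (λ y<f → ℕP.m<n⇒m<1+n (ℕP.<-≤-trans y<f (ℕP.m≤n+m _ x))) (fresh-> xs)

fresh-≥-length : ∀ xs → length xs ≤ fresh xs
fresh-≥-length [] = ℕ.z≤n
fresh-≥-length (x ∷ xs) = s≤s (ℕP.≤-trans (fresh-≥-length xs) (ℕP.m≤n+m _ x))

fresh-block-outside : ∀ xs → let B = block (fresh xs) (length xs) in All (Outside 0 (length B)) B
fresh-block-outside xs rewrite length-block (fresh xs) (length xs) =
  All.map (λ f≤y → inj₂ (ℕP.≤-trans (fresh-≥-length xs) f≤y)) (block-≥ (fresh xs) (length xs))

-- Fm has no substitution, so the variables 0, 1, … of φ receive the values of xs by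
-- first copying them into fresh variables, which avoids clobbering a source.
instantiate : ∀ {Γ} → List Var → Fm Γ → Fm Γ
instantiate xs φ = assignFrom (fresh xs) xs (assignFrom 0 (block (fresh xs) (length xs)) φ)

assignFrom-InL : ∀ {Γ} L t xs {φ : Fm Γ} → InL L φ → InL L (assignFrom t xs φ)
assignFrom-InL L t [] φ∈L = φ∈L
assignFrom-InL L t (x ∷ xs) φ∈L = _ , assignFrom-InL L (suc t) xs φ∈L

instantiate-InL : ∀ {Γ} L xs (φ : Fm Γ) → InL L φ → InL L (instantiate xs φ)
instantiate-InL L xs φ =
  assignFrom-InL L (fresh xs) xs ∘ assignFrom-InL L 0 (block (fresh xs) (length xs)) {φ}

anyOf : ∀ {Γ} → List ℕ → (ℕ → Fm Γ) → Fm Γ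
anyOf [] f = ff
anyOf (z ∷ zs) f = or (f z) (anyOf zs f)

inRoleAt : Var → Var → RoleName → Fm []
inRoleAt x t P = ex (suc t) (or (rAt P x (suc t) t) (rAt P (suc t) x t))

indFormula : Signature → Var → Fm []
indFormula Σ' x = ex (suc x)
  (or (anyOf (concepts Σ') (λ A → cAt A x (suc x))) (anyOf (roles Σ') (inRoleAt x (suc x))))

anyOf-InL : ∀ {Γ} L zs (f : ℕ → Fm Γ) → (∀ z → InL L (f z)) → InL L (anyOf zs f)
anyOf-InL L [] f f∈L = _
anyOf-InL L (z ∷ zs) f f∈L = f∈L z , anyOf-InL L zs f f∈L

indFormula-InL : ∀ L Σ' x → InL L (indFormula Σ' x)
indFormula-InL L Σ' x =
  anyOf-InL L (concepts Σ') _ (λ _ → _) , anyOf-InL L (roles Σ') (inRoleAt x (suc x)) (λ _ → _ , _)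

module _ (𝒜 : ABox) where

  anyOf-sem : ∀ {Γ} {η : PEnv Γ} {ρ} zs (f : ℕ → Fm Γ)
    → Eval 𝒜 (anyOf zs f) ρ η ⇔ Any (λ z → Eval 𝒜 (f z) ρ η) zs
  anyOf-sem [] f = mk⇔ (λ ()) (λ ())
  anyOf-sem (z ∷ zs) f = mk⇔
    (λ { (inj₁ fz) → here fz ; (inj₂ fzs) → there (to (anyOf-sem zs f) fzs) })
    (λ { (here fz) → inj₁ fz ; (there fzs) → inj₂ (from (anyOf-sem zs f) fzs) })

  WithinTem : (Var → ℕ) → Set
  WithinTem ρ = ∀ v → InTem 𝒜 (+ ρ v)

  letIn-sem : ∀ {Γ} {φ : Fm Γ} {η : PEnv Γ} {ρ} u a → u ≢ a → InTem 𝒜 (+ ρ a)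
    → Eval 𝒜 (letIn u a φ) ρ η ⇔ Eval 𝒜 φ (ρ [ u ↦ ρ a ]) η
  letIn-sem {φ = φ} {η} {ρ} u a u≢a ρa∈tem = mk⇔ bound binder
    where
    bound : Eval 𝒜 (letIn u a φ) ρ η → Eval 𝒜 φ (ρ [ u ↦ ρ a ]) η
    bound (n , _ , u≡a , φn) = subst (λ k → Eval 𝒜 φ (ρ [ u ↦ k ]) η)
      (trans (sym (update-same ρ u n)) (trans u≡a (update-other ρ u n u≢a))) φn
    binder : Eval 𝒜 φ (ρ [ u ↦ ρ a ]) η → Eval 𝒜 (letIn u a φ) ρ η
    binder φa = ρ a , ρa∈tem
      , trans (update-same ρ u (ρ a)) (sym (update-other ρ u (ρ a) u≢a)) , φa

  assignFrom-sem : ∀ {Γ} {φ : Fm Γ} {η : PEnv Γ} t xs {ρ}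
    → WithinTem ρ → All (Outside t (length xs)) xs
    → Σ[ ρ' ∈ (Var → ℕ) ] (WithinTem ρ' × (∀ {y} → y < t → ρ' y ≡ ρ y)
        × map ρ' (block t (length xs)) ≡ map ρ xs
        × (Eval 𝒜 (assignFrom t xs φ) ρ η ⇔ Eval 𝒜 φ ρ' η))
  assignFrom-sem t [] {ρ} ρ∈tem [] = ρ , ρ∈tem , (λ _ → refl) , refl , mk⇔ id id
  assignFrom-sem {φ = φ} {η} t (x ∷ xs) {ρ} ρ∈tem (x-out ∷ xs-out)
    with assignFrom-sem {φ = φ} {η} (suc t) xs
           (update-preserves ρ t (ρ x) (InTem 𝒜 ∘ +_) ρ∈tem (ρ∈tem x))
           (All.map outside-suc xs-out)
  ... | ρ' , ρ'∈tem , below , values , sem =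
    ρ' , ρ'∈tem , below′ , values′
      , sem ⇔-∘ letIn-sem {φ = assignFrom (suc t) xs φ} {η} t x (outside-≢ x-out) (ρ∈tem x)
    where
    below′ : ∀ {y} → y < t → ρ' y ≡ ρ y
    below′ y<t = trans (below (ℕP.m<n⇒m<1+n y<t)) (update-other ρ t (ρ x) (ℕP.>⇒≢ y<t))
    values′ : ρ' t ∷ map ρ' (block (suc t) (length xs)) ≡ ρ x ∷ map ρ xs
    values′ = cong₂ _∷_ (trans (below (ℕP.n<1+n t)) (update-same ρ t (ρ x)))
      (trans values (map-cong-local (All.map (update-other ρ t (ρ x) ∘ outside-≢) xs-out)))

  instantiate-sem : ∀ {Γ} {φ : Fm Γ} {η : PEnv Γ} xs {ρ} → WithinTem ρ
    → Σ[ ρ' ∈ (Var → ℕ) ] (WithinTem ρ' × map ρ' (block 0 (length xs)) ≡ map ρ xs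
        × (Eval 𝒜 (instantiate xs φ) ρ η ⇔ Eval 𝒜 φ ρ' η))
  instantiate-sem {φ = φ} {η} xs ρ∈tem
    with assignFrom-sem {φ = assignFrom 0 (block (fresh xs) (length xs)) φ} {η} (fresh xs) xs ρ∈tem
           (All.map inj₁ (fresh-> xs))
  ... | ρ₁ , ρ₁∈tem , _ , values₁ , sem₁
    with assignFrom-sem {φ = φ} {η} 0 (block (fresh xs) (length xs)) ρ₁∈tem (fresh-block-outside xs)
  ... | ρ₂ , ρ₂∈tem , _ , values₂ , sem₂ =
    ρ₂ , ρ₂∈tem , trans values₂′ values₁ , sem₂ ⇔-∘ sem₁
    where
    values₂′ : map ρ₂ (block 0 (length xs)) ≡ map ρ₁ (block (fresh xs) (length xs))
    values₂′ = subst (λ k → map ρ₂ (block 0 k) ≡ map ρ₁ (block (fresh xs) (length xs)))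
                     (length-block (fresh xs) (length xs)) values₂

module _ {𝒜 : ABox} (norm : Normalised 𝒜) where

  time-ℕ : ∀ {α} → α ∈ 𝒜 → ∃ λ n → time α ≡ + n
  time-ℕ {α} α∈𝒜 = _ , sym (0≤i⇒+∣i∣≡i (proj₁ (proj₂ norm) α α∈𝒜))

  time-∈-tem : ∀ {α} → α ∈ 𝒜 → InTem 𝒜 (time α)
  time-∈-tem {α} α∈𝒜 = (α , α∈𝒜 , ≤-refl) , (α , α∈𝒜 , ≤-refl)

  tem-elim : ∀ {P : ℤ → Set₁} → (∀ n → InTem 𝒜 (+ n) → P (+ n)) → ∀ {ℓ} → InTem 𝒜 ℓ → P ℓ
  tem-elim {P} P+ {ℓ} ℓ∈tem@((α , α∈𝒜 , α≤ℓ) , _) =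
    subst P ℓ≡n (P+ ℤ.∣ ℓ ∣ (subst (InTem 𝒜) (sym ℓ≡n) ℓ∈tem))
    where
    ℓ≡n : + ℤ.∣ ℓ ∣ ≡ ℓ
    ℓ≡n = 0≤i⇒+∣i∣≡i (≤-trans (proj₁ (proj₂ norm) α α∈𝒜) α≤ℓ)

  -- Normalisation puts the individuals 0, …, m inside tem(𝒜) = {0, …, max 𝒜}.
  ind⊆tem : ∀ {a} → InInd 𝒜 a → InTem 𝒜 (+ a)
  ind⊆tem {a} a∈ind =
    let (α₀ , α₀∈𝒜 , α₀≡0) , _ , (m , ind≡≤m , (α , α∈𝒜 , _ , m≤α)) = norm
    in (α₀ , α₀∈𝒜 , subst (_≤ℤ + a) (sym α₀≡0) (ℤ.+≤+ ℕ.z≤n))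
     , (α , α∈𝒜 , ≤-trans (ℤ.+≤+ (to (ind≡≤m a) a∈ind)) m≤α)

module _ (Σ' : Signature) {𝒜 : ABox} (sig : SigABox Σ' 𝒜) (norm : Normalised 𝒜)
         {η : PEnv []} {ρ : Var → ℕ} (x : Var) where

  private
    t = suc x
    y = suc t
    t≢x : t ≢ x
    t≢x = ℕP.>⇒≢ (ℕP.n<1+n x)
    y≢t : y ≢ t
    y≢t = ℕP.>⇒≢ (ℕP.n<1+n t)
    ρ[t] : ℕ → Var → ℕ
    ρ[t] n = ρ [ t ↦ n ]
    x-kept : ∀ n k → (ρ[t] n [ y ↦ k ]) x ≡ ρ x
    x-kept n k = trans (update-other (ρ[t] n) y k (ℕP.>⇒≢ (ℕP.m<n⇒m<1+n (ℕP.n<1+n x))))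
                       (update-other ρ t n t≢x)
    t-set : ∀ n k → (ρ[t] n [ y ↦ k ]) t ≡ n
    t-set n k = trans (update-other (ρ[t] n) y k y≢t) (update-same ρ t n)
    cAss-∈ : ∀ {A a a' n n'} → a ≡ a' → n ≡ n' → cAss A a (+ n) ∈ 𝒜 → cAss A a' (+ n') ∈ 𝒜
    cAss-∈ refl refl α∈𝒜 = α∈𝒜
    rAss-∈ : ∀ {P a a' b b' n n'} → a ≡ a' → b ≡ b' → n ≡ n'
      → rAss P a b (+ n) ∈ 𝒜 → rAss P a' b' (+ n') ∈ 𝒜
    rAss-∈ refl refl refl α∈𝒜 = α∈𝒜

  indFormula-sound : Eval 𝒜 (indFormula Σ' x) ρ η → InInd 𝒜 (ρ x)
  indFormula-sound (n , _ , inj₁ by-concept)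
    with satisfied (to (anyOf-sem 𝒜 (concepts Σ') _) by-concept)
  ... | _ , α∈𝒜 = subst (InInd 𝒜) (update-other ρ t n t≢x) (_ , α∈𝒜 , inC)
  indFormula-sound (n , _ , inj₂ by-role) with satisfied (to (anyOf-sem 𝒜 (roles Σ') _) by-role)
  ... | _ , k , _ , inj₁ α∈𝒜 = subst (InInd 𝒜) (x-kept n k) (_ , α∈𝒜 , inR₁)
  ... | _ , k , _ , inj₂ α∈𝒜 = subst (InInd 𝒜) (x-kept n k) (_ , α∈𝒜 , inR₂)

  indFormula-complete : InInd 𝒜 (ρ x) → Eval 𝒜 (indFormula Σ' x) ρ η
  indFormula-complete (α , α∈𝒜 , _) with time-ℕ norm α∈𝒜
  indFormula-complete (cAss A _ _ , α∈𝒜 , inC) | n , refl =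
    n , time-∈-tem norm α∈𝒜 , inj₁ (from (anyOf-sem 𝒜 (concepts Σ') _) (lose (sig _ α∈𝒜)
      (cAss-∈ (sym (update-other ρ t n t≢x)) (sym (update-same ρ t n)) α∈𝒜)))
  indFormula-complete (rAss P _ b _ , α∈𝒜 , inR₁) | n , refl =
    n , time-∈-tem norm α∈𝒜 , inj₂ (from (anyOf-sem 𝒜 (roles Σ') _) (lose (sig _ α∈𝒜)
      (b , ind⊆tem norm (_ , α∈𝒜 , inR₂) , inj₁
        (rAss-∈ (sym (x-kept n b)) (sym (update-same (ρ[t] n) y b)) (sym (t-set n b)) α∈𝒜))))
  indFormula-complete (rAss P b _ _ , α∈𝒜 , inR₂) | n , refl =
    n , time-∈-tem norm α∈𝒜 , inj₂ (from (anyOf-sem 𝒜 (roles Σ') _) (lose (sig _ α∈𝒜)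
      (b , ind⊆tem norm (_ , α∈𝒜 , inR₁) , inj₂
        (rAss-∈ (sym (update-same (ρ[t] n) y b)) (sym (x-kept n b)) (sym (t-set n b)) α∈𝒜))))

  indFormula-sem : Eval 𝒜 (indFormula Σ' x) ρ η ⇔ InInd 𝒜 (ρ x)
  indFormula-sem = mk⇔ indFormula-sound indFormula-complete

Admissible : ABox → (IVar → IndName) → (TVar → ℤ) → Set
Admissible 𝒜 σ τ = (∀ i → InInd 𝒜 (σ i)) × (∀ j → InTem 𝒜 (τ j))

Encodes : (IVar → IndName) → (TVar → ℤ) → (Var → ℕ) → Set
Encodes σ τ ρ = (∀ i → ρ (ivar i) ≡ σ i) × (∀ j → + ρ (tvar j) ≡ τ j)

interleave-encodes : ∀ σ τ → Encodes σ (+_ ∘ τ) (interleave σ τ)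
interleave-encodes σ τ = interleave-ivar σ τ , cong +_ ∘ interleave-tvar σ τ

encodes-updateᵢ : ∀ {σ τ ρ} x a → Encodes σ τ ρ → Encodes (σ [ x ↦ a ]) τ (ρ [ ivar x ↦ a ])
encodes-updateᵢ {ρ = ρ} x a (ρ≡σ , ρ≡τ) =
  update-reindex id ivar-injective ρ≡σ x a ,
  λ j → trans (cong +_ (update-other ρ (ivar x) a (ivar≢tvar x j))) (ρ≡τ j)

encodes-updateₜ : ∀ {σ τ ρ} t n → Encodes σ τ ρ → Encodes σ (τ [ t ↦ + n ]) (ρ [ tvar t ↦ n ])
encodes-updateₜ {ρ = ρ} t n (ρ≡σ , ρ≡τ) =
  (λ i → trans (update-other ρ (tvar t) n (ivar≢tvar i t ∘ sym)) (ρ≡σ i)) ,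
  update-reindex +_ tvar-injective ρ≡τ t n

module _ {𝒜 : ABox} where

  encodes-within : ∀ {σ τ ρ} → Normalised 𝒜 → Admissible 𝒜 σ τ → Encodes σ τ ρ → WithinTem 𝒜 ρ
  encodes-within norm (σ∈ind , τ∈tem) (ρ≡σ , ρ≡τ) v with ivar-or-tvar v
  ... | inj₁ (i , refl) = subst (InTem 𝒜 ∘ +_) (sym (ρ≡σ i)) (ind⊆tem norm (σ∈ind i))
  ... | inj₂ (j , refl) = subst (InTem 𝒜) (sym (ρ≡τ j)) (τ∈tem j)

  admissible-updateᵢ : ∀ {σ τ} x {a} → InInd 𝒜 a → Admissible 𝒜 σ τ
    → Admissible 𝒜 (σ [ x ↦ a ]) τ
  admissible-updateᵢ {σ} x {a} a∈ind (σ∈ind , τ∈tem) =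
    update-preserves σ x a (InInd 𝒜) σ∈ind a∈ind , τ∈tem

  admissible-updateₜ : ∀ {σ τ} t {ℓ} → InTem 𝒜 ℓ → Admissible 𝒜 σ τ
    → Admissible 𝒜 σ (τ [ t ↦ ℓ ])
  admissible-updateₜ {τ = τ} t {ℓ} ℓ∈tem (σ∈ind , τ∈tem) =
    σ∈ind , update-preserves τ t ℓ (InTem 𝒜) τ∈tem ℓ∈tem

module Translate (L : Logic) (Σ' : Signature) (𝒪 : Ontology) where

  Correct : QFormula → Fm [] → Set₁
  Correct ψ Q = ∀ {𝒜} → SigABox Σ' 𝒜 → Normalised 𝒜 → ∀ {σ τ ρ}
    → Admissible 𝒜 σ τ → Encodes σ τ ρ → QTrue 𝒪 𝒜 ψ σ τ ⇔ Eval 𝒜 Q ρ (λ ())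

  record Translation (ψ : QFormula) : Set₁ where
    field
      formula : Fm []
      formula-InL : InL L formula
      correct : Correct ψ formula
  open Translation

  translation-cAtom : ∀ {κ} x t → RewritableC L Σ' 𝒪 κ → Translation (cAtom κ x t)
  translation-cAtom {κ} x t (Q , Q∈L , Q-correct) = record
    { formula = instantiate (ivar x ∷ tvar t ∷ []) Q
    ; formula-InL = instantiate-InL L (ivar x ∷ tvar t ∷ []) Q Q∈L
    ; correct = correct′
    }
    where
    correct′ : Correct (cAtom κ x t) (instantiate (ivar x ∷ tvar t ∷ []) Q)
    correct′ {𝒜} sig norm {σ} {τ} adm@(σ∈ind , _) enc@(ρ≡σ , ρ≡τ)
      with instantiate-sem 𝒜 {φ = Q} {λ ()} (ivar x ∷ tvar t ∷ []) (encodes-within norm adm enc)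
    ... | ρ' , ρ'∈tem , values , sem =
      ⇔-sym sem ⇔-∘ subst₂ (λ a ℓ → CertainC 𝒪 κ 𝒜 a ℓ ⇔ Eval 𝒜 Q ρ' (λ ())) x≡ t≡
        (⇔-sym (Q-correct 𝒜 sig norm ρ' ρ'∈tem (subst (InInd 𝒜) (sym x≡) (σ∈ind x))))
      where
      x≡ : ρ' 0 ≡ σ x
      x≡ = trans (∷-injectiveˡ values) (ρ≡σ x)
      t≡ : + ρ' 1 ≡ τ t
      t≡ = trans (cong +_ (∷-injectiveˡ (∷-injectiveʳ values))) (ρ≡τ t)

  translation-rAtom : ∀ {ϱ} x y t → RewritableR L Σ' 𝒪 ϱ → Translation (rAtom ϱ x y t)
  translation-rAtom {ϱ} x y t (Q , Q∈L , Q-correct) = record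
    { formula = instantiate (ivar x ∷ ivar y ∷ tvar t ∷ []) Q
    ; formula-InL = instantiate-InL L (ivar x ∷ ivar y ∷ tvar t ∷ []) Q Q∈L
    ; correct = correct′
    }
    where
    correct′ : Correct (rAtom ϱ x y t) (instantiate (ivar x ∷ ivar y ∷ tvar t ∷ []) Q)
    correct′ {𝒜} sig norm {σ} {τ} adm@(σ∈ind , _) enc@(ρ≡σ , ρ≡τ)
      with instantiate-sem 𝒜 {φ = Q} {λ ()} (ivar x ∷ ivar y ∷ tvar t ∷ [])
             (encodes-within norm adm enc)
    ... | ρ' , ρ'∈tem , values , sem =
      ⇔-sym sem ⇔-∘ subst₂ (λ (a , b) ℓ → CertainR 𝒪 ϱ 𝒜 a b ℓ ⇔ Eval 𝒜 Q ρ' (λ ()))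
                           (cong₂ _,_ x≡ y≡) t≡
        (⇔-sym (Q-correct 𝒜 sig norm ρ' ρ'∈tem (subst (InInd 𝒜) (sym x≡) (σ∈ind x))
                                               (subst (InInd 𝒜) (sym y≡) (σ∈ind y))))
      where
      x≡ : ρ' 0 ≡ σ x
      x≡ = trans (∷-injectiveˡ values) (ρ≡σ x)
      y≡ : ρ' 1 ≡ σ y
      y≡ = trans (∷-injectiveˡ (∷-injectiveʳ values)) (ρ≡σ y)
      t≡ : + ρ' 2 ≡ τ t
      t≡ = trans (cong +_ (∷-injectiveˡ (∷-injectiveʳ (∷-injectiveʳ values)))) (ρ≡τ t)

  translation-< : ∀ t t' → Translation (tLess t t')
  translation-< t t' = record
    { formula = ltAt (tvar t) (tvar t')
    ; formula-InL = _
    ; correct = λ _ _ _ (_ , ρ≡τ) →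
        mk⇔ (λ (lift t<t') → drop‿+<+ (subst₂ _<ℤ_ (sym (ρ≡τ t)) (sym (ρ≡τ t')) t<t'))
            (λ t<t' → lift (subst₂ _<ℤ_ (ρ≡τ t) (ρ≡τ t') (+<+ t<t')))
    }

  translation-⊤ : Translation qtrue
  translation-⊤ = record { formula = tt ; formula-InL = _ ; correct = λ _ _ _ _ → mk⇔ _ _ }

  translation-⊥ : Translation qfalse
  translation-⊥ = record { formula = ff ; formula-InL = _ ; correct = λ _ _ _ _ → mk⇔ lower λ () }

  translation-¬ : ∀ {φ} → Translation φ → Translation (qnot φ)
  translation-¬ T = record
    { formula = neg (formula T)
    ; formula-InL = formula-InL T
    ; correct = λ sig norm adm enc → ¬-cong-⇔ (correct T sig norm adm enc)
    }

  translation-∧ : ∀ {φ χ} → Translation φ → Translation χ → Translation (qand φ χ)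
  translation-∧ T U = record
    { formula = and (formula T) (formula U)
    ; formula-InL = formula-InL T , formula-InL U
    ; correct = λ sig norm adm enc → correct T sig norm adm enc ×-⇔ correct U sig norm adm enc
    }

  translation-∨ : ∀ {φ χ} → Translation φ → Translation χ → Translation (qor φ χ)
  translation-∨ T U = record
    { formula = or (formula T) (formula U)
    ; formula-InL = formula-InL T , formula-InL U
    ; correct = λ sig norm adm enc → correct T sig norm adm enc ⊎-⇔ correct U sig norm adm enc
    }

  translation-⇒ : ∀ {φ χ} → Translation φ → Translation χ → Translation (qimp φ χ)
  translation-⇒ T U = record
    { formula = imp (formula T) (formula U)
    ; formula-InL = formula-InL T , formula-InL U
    ; correct = λ sig norm adm enc →
        →-cong-⇔ (correct T sig norm adm enc) (correct U sig norm adm enc)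
    }

  module _ {φ} (T : Translation φ) {𝒜} (sig : SigABox Σ' 𝒜) (norm : Normalised 𝒜)
           {σ τ ρ} (adm : Admissible 𝒜 σ τ) (enc : Encodes σ τ ρ) where

    correct-bindᵢ : ∀ x a → InInd 𝒜 a
      → QTrue 𝒪 𝒜 φ (σ [ x ↦ a ]) τ ⇔ Eval 𝒜 (formula T) (ρ [ ivar x ↦ a ]) (λ ())
    correct-bindᵢ x a a∈ind =
      correct T sig norm (admissible-updateᵢ x a∈ind adm) (encodes-updateᵢ x a enc)

    correct-bindₜ : ∀ t n → InTem 𝒜 (+ n)
      → QTrue 𝒪 𝒜 φ σ (τ [ t ↦ + n ]) ⇔ Eval 𝒜 (formula T) (ρ [ tvar t ↦ n ]) (λ ())
    correct-bindₜ t n n∈tem =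
      correct T sig norm (admissible-updateₜ t n∈tem adm) (encodes-updateₜ t n enc)

    indFormula-bound : ∀ x a
      → Eval 𝒜 (indFormula Σ' (ivar x)) (ρ [ ivar x ↦ a ]) (λ ()) ⇔ InInd 𝒜 a
    indFormula-bound x a = subst (λ b → Eval 𝒜 ind-x (ρ [ ivar x ↦ a ]) (λ ()) ⇔ InInd 𝒜 b)
      (update-same ρ (ivar x) a) (indFormula-sem Σ' sig norm {ρ = ρ [ ivar x ↦ a ]} (ivar x))
      where ind-x = indFormula Σ' (ivar x)

  translation-∃ᵢ : ∀ x {φ} → Translation φ → Translation (qexI x φ)
  translation-∃ᵢ x {φ} T = record
    { formula = ex (ivar x) (and (indFormula Σ' (ivar x)) (formula T))
    ; formula-InL = indFormula-InL L Σ' (ivar x) , formula-InL T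
    ; correct = λ sig norm adm enc →
        let body = correct-bindᵢ T sig norm adm enc x
            ind = indFormula-bound T sig norm adm enc x
        in mk⇔ (λ (a , lift a∈ind , φa) →
                  a , ind⊆tem norm a∈ind , from (ind a) a∈ind , to (body a a∈ind) φa)
               (λ (n , _ , n∈ind , φn) →
                  n , lift (to (ind n) n∈ind) , from (body n (to (ind n) n∈ind)) φn)
    }

  translation-∀ᵢ : ∀ x {φ} → Translation φ → Translation (qallI x φ)
  translation-∀ᵢ x {φ} T = record
    { formula = all (ivar x) (imp (indFormula Σ' (ivar x)) (formula T))
    ; formula-InL = indFormula-InL L Σ' (ivar x) , formula-InL T
    ; correct = λ sig norm adm enc →
        let body = correct-bindᵢ T sig norm adm enc x
            ind = indFormula-bound T sig norm adm enc x
        in mk⇔ (λ φ-all n _ n∈ind → to (body n (to (ind n) n∈ind)) (φ-all n (to (ind n) n∈ind)))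
               (λ φ-all a a∈ind →
                  from (body a a∈ind) (φ-all a (ind⊆tem norm a∈ind) (from (ind a) a∈ind)))
    }

  translation-∃ₜ : ∀ t {φ} → Translation φ → Translation (qexT t φ)
  translation-∃ₜ t {φ} T = record
    { formula = ex (tvar t) (formula T)
    ; formula-InL = formula-InL T
    ; correct = λ {𝒜} sig norm {σ} {τ} {ρ} adm enc →
        let body = correct-bindₜ T sig norm adm enc t
        in mk⇔ (λ (ℓ , lift ℓ∈tem , φℓ) →
                  tem-elim norm {P = λ ℓ → QTrue 𝒪 𝒜 φ σ (τ [ t ↦ ℓ ])
                                         → Eval 𝒜 (ex (tvar t) (formula T)) ρ (λ ())}
                    (λ n n∈tem φn → n , n∈tem , to (body n n∈tem) φn) ℓ∈tem φℓ)
               (λ (n , n∈tem , φn) → + n , lift n∈tem , from (body n n∈tem) φn)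
    }

  translation-∀ₜ : ∀ t {φ} → Translation φ → Translation (qallT t φ)
  translation-∀ₜ t {φ} T = record
    { formula = all (tvar t) (formula T)
    ; formula-InL = formula-InL T
    ; correct = λ {𝒜} sig norm {σ} {τ} adm enc →
        let body = correct-bindₜ T sig norm adm enc t
        in mk⇔ (λ φ-all n n∈tem → to (body n n∈tem) (φ-all (+ n) n∈tem))
               (λ φ-all ℓ ℓ∈tem → tem-elim norm {P = λ ℓ → QTrue 𝒪 𝒜 φ σ (τ [ t ↦ ℓ ])}
                  (λ n n∈tem → from (body n n∈tem) (φ-all n n∈tem)) ℓ∈tem)
    }

  translate : ∀ ψ → All (RewritableC L Σ' 𝒪) (conceptsOf ψ) → All (RewritableR L Σ' 𝒪) (rolesOf ψ)
    → Translation ψ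
  translate qtrue _ _ = translation-⊤
  translate qfalse _ _ = translation-⊥
  translate (cAtom κ x t) (Rκ ∷ []) _ = translation-cAtom x t Rκ
  translate (rAtom ϱ x y t) _ (Rϱ ∷ []) = translation-rAtom x y t Rϱ
  translate (tLess t t') _ _ = translation-< t t'
  translate (qnot φ) Rκs Rϱs = translation-¬ (translate φ Rκs Rϱs)
  translate (qand φ χ) Rκs Rϱs = translation-∧
    (translate φ (++⁻ˡ _ Rκs) (++⁻ˡ _ Rϱs)) (translate χ (++⁻ʳ _ Rκs) (++⁻ʳ _ Rϱs))
  translate (qor φ χ) Rκs Rϱs = translation-∨
    (translate φ (++⁻ˡ _ Rκs) (++⁻ˡ _ Rϱs)) (translate χ (++⁻ʳ _ Rκs) (++⁻ʳ _ Rϱs))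
  translate (qimp φ χ) Rκs Rϱs = translation-⇒
    (translate φ (++⁻ˡ _ Rκs) (++⁻ˡ _ Rϱs)) (translate χ (++⁻ʳ _ Rκs) (++⁻ʳ _ Rϱs))
  translate (qexI x φ) Rκs Rϱs = translation-∃ᵢ x (translate φ Rκs Rϱs)
  translate (qallI x φ) Rκs Rϱs = translation-∀ᵢ x (translate φ Rκs Rϱs)
  translate (qexT t φ) Rκs Rϱs = translation-∃ₜ t (translate φ Rκs Rϱs)
  translate (qallT t φ) Rκs Rϱs = translation-∀ₜ t (translate φ Rκs Rϱs)

theorem41 : (L : Logic) (Σ' : Signature) (𝒪 : Ontology) (ψ : QFormula)
    → (∀ κ → κ ∈ conceptsOf ψ → RewritableC L Σ' 𝒪 κ)
    → (∀ ϱ → ϱ ∈ rolesOf ψ → RewritableR L Σ' 𝒪 ϱ)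
    → RewritableQ L Σ' 𝒪 ψ
theorem41 L Σ' 𝒪 ψ κ-rewritable ϱ-rewritable =
  formula T , formula-InL T ,
  λ 𝒜 sig norm σ τ σ∈ind τ∈tem → correct T sig norm (σ∈ind , τ∈tem) (interleave-encodes σ τ)
  where
  open Translate L Σ' 𝒪
  open Translation
  T : Translation ψ
  T = translate ψ (All.tabulate (κ-rewritable _)) (All.tabulate (ϱ-rewritable _))
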